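{- Let $A$ be a $d$-dimensional double permutation of order $n$. Suppose there is an integer $k$ with $2\le k\le d-1$ such that the support of every $k$-dimensional plane of $A$ and the support of every $(k+1)$-dimensional plane of $A$ is a connected bitrade (within that plane). Then the support $U$ of $A$ is a connected bitrade.
   Context: A $d$-dimensional matrix of order $n$ is an array $A=(a_\alpha)_{\alpha\in I_n^d}$, $I_n^d=\{0,\dots,n-1\}^d$. A $k$-dimensional plane is obtained by fixing $d-k$ coordinates and letting the other $k$ vary; lines are $1$-dimensional planes. A double permutation is a nonnegative matrix all of whose entries lie in $\{0,1/2\}$ and each line of which sums to $1$ (so each line contains exactly two nonzero entries). The support of $A$ is $\{\alpha: a_\alpha\neq0\}$. A set $U\subseteq I_n^d$ is a unitrade if every line contains $0$ or $2$ elements of $U$. Consider the graph on $U$ in which two elements are adjacent iff they lie on a common line; $U$ is connected if this graph is connected, and $U$ is a bitrade if this graph is bipartite, i.e. there is $\sigma:U\to\{\pm1\}$ with $\sigma(\alpha)\ne\sigma(\beta)$ whenever $\alpha\ne\beta$ lie on a common line. The support of a plane is regarded as a subset of the index set of that plane. -}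

module Defs where

open import Data.Nat using (ℕ; _≤_; _+_)
open import Data.Fin using (Fin; _≟_)
open import Data.Fin.Subset using (Subset; _∈_; _∉_; ∣_∣)
open import Data.Bool using (Bool)
open import Data.Unit using (⊤)
open import Data.Rational using (ℚ; 0ℚ; 1ℚ; ½; _+_)
open import Data.Vec.Functional using (updateAt; foldr)
open import Data.Product using (Σ; ∃; _×_; _,_)
open import Data.Sum using (_⊎_)
open import Data.List using (List; []; _∷_)
open import Function using (const)
open import Relation.Binary.PropositionalEquality using (_≡_; _≢_)
open import Relation.Nullary using (¬_)

Idx : ℕ → ℕ → Set
Idx d n = Fin d → Fin n

Matrix : ℕ → ℕ → Set
Matrix d n = Idx d n → ℚ

_[_≔_] : ∀ {d n} → Idx d n → Fin d → Fin n → Idx d n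
α [ i ≔ t ] = updateAt α i (const t)

lineSum : ∀ {d n} → Matrix d n → Idx d n → Fin d → ℚ
lineSum A α i = foldr Data.Rational._+_ 0ℚ (λ t → A (α [ i ≔ t ]))

DoublePermutation : ∀ {d n} → Matrix d n → Set
DoublePermutation {d} {n} A =
  ((α : Idx d n) → (A α ≡ 0ℚ) ⊎ (A α ≡ ½)) ×
  ((α : Idx d n) (i : Fin d) → lineSum A α i ≡ 1ℚ)

Support : ∀ {d n} → Matrix d n → Idx d n → Set
Support A α = A α ≢ 0ℚ

InPlane : ∀ {d n} → Subset d → Idx d n → Idx d n → Set
InPlane {d} S β α = (j : Fin d) → j ∉ S → α j ≡ β j

Adjacent : ∀ {d n} → Idx d n → Idx d n → Set
Adjacent {d} α γ = α ≢ γ × Σ (Fin d) (λ i → (j : Fin d) → j ≢ i → α j ≡ γ j)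

UnitradeIn : ∀ {d n} → Subset d → (Idx d n → Set) → (Idx d n → Set) → Set
UnitradeIn {d} {n} S P U =
  (α : Idx d n) → P α → (i : Fin d) → i ∈ S →
    ((t : Fin n) → ¬ U (α [ i ≔ t ])) ⊎
    Σ (Fin n) (λ t₁ → Σ (Fin n) (λ t₂ →
      t₁ ≢ t₂ × U (α [ i ≔ t₁ ]) × U (α [ i ≔ t₂ ]) ×
      ((t : Fin n) → U (α [ i ≔ t ]) → (t ≡ t₁) ⊎ (t ≡ t₂))))

data PathIn {d n : ℕ} (P : Idx d n → Set) (U : Idx d n → Set)
     : Idx d n → Idx d n → Set where
  here : ∀ {α} → PathIn P U α α
  step : ∀ {α γ δ} → U γ → P γ → Adjacent α γ →
         PathIn P U γ δ → PathIn P U α δ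

ConnectedIn : ∀ {d n} → (Idx d n → Set) → (Idx d n → Set) → Set
ConnectedIn {d} {n} P U =
  (α γ : Idx d n) → U α → P α → U γ → P γ → PathIn P U α γ

BitradeIn : ∀ {d n} → Subset d → (Idx d n → Set) → (Idx d n → Set) → Set
BitradeIn {d} {n} S P U =
  UnitradeIn S P U ×
  Σ (Idx d n → Bool) (λ σ → (α γ : Idx d n) →
     U α → P α → U γ → P γ → Adjacent α γ → σ α ≢ σ γ)

full : ∀ {d} → Subset d
full = Data.Fin.Subset.⊤

AllPlanesConnectedBitrade : ∀ {d n} → Matrix d n → ℕ → Set
AllPlanesConnectedBitrade {d} {n} A k =
  (S : Subset d) → ∣ S ∣ ≡ k → (β : Idx d n) →
    ConnectedIn (InPlane S β) (Support A) × BitradeIn S (InPlane S β) (Support A)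

Everything : ∀ {d n} → Idx d n → Set
Everything _ = ⊤

SupportConnectedBitrade : ∀ {d n} → Matrix d n → Set
SupportConnectedBitrade A = ConnectedIn Everything (Support A) × BitradeIn full Everything (Support A)

-- By induction on m, the support is a connected bitrade inside every plane spanned by the
-- directions below m, starting from m = k + 1.  Such a plane Π for m + 1 is the union of its
-- slices (coordinate m fixed), which are connected bitrades by induction.  Every line of a double
-- permutation meets the support, so inside a (k+1)-plane containing direction m ("vertical") each
-- point reaches every slice: Π is connected.  Colour each slice by its own colouring, flipped to
-- agree with a fixed vertical (k+1)-plane Q₀ at a reference point of the slice.  Along a path, two
-- proper colourings change by the parity of its length, so on a connected common part they agree
-- up to a constant.  Hence agreement with the slice-wise colouring passes between vertical
-- (k+1)-planes meeting in a vertical k-plane (k ≥ 2 leaves a horizontal direction in it through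
-- which every slice reaches it), and from Q₀ to every translate of it, one coordinate at a time.
-- Edges in direction m lie in such a translate, so the slice-wise colouring is proper on Π.
-- The unitrade property is read off the (k+1)-plane through each line.

module Submission where

open import Defs
open import Data.Nat using (ℕ; zero; suc; _≤_; _<_; _+_; _∸_; _⊔_; s≤s; z<s; s≤s⁻¹)
open import Data.Nat.Properties
  using (_<?_; ≤-reflexive; <-trans; <-≤-trans; <⇒≤; <⇒≱; ≮⇒≥; ≤∧≢⇒<; ≤∧≮⇒≡; <-irrefl;
         m≤n+m; m≤n⇒m≤1+n; n<1+n; +-comm; +-suc; m≤n⇒m⊔n≡n; m≤m⊔n; ⊔-lub; m∸n+n≡m)
import Data.Nat.Properties as ℕ
open import Data.Bool using (Bool; true; false; not; _xor_; if_then_else_)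
open import Data.Bool.Properties using (xor-assoc; xor-comm; xor-same; ¬-not; not-distribˡ-xor)
open import Data.Fin using (Fin; toℕ; fromℕ<)
import Data.Fin as Fin
open import Data.Fin.Properties using (toℕ-injective; toℕ-fromℕ<; toℕ<n; ¬∀⟶∃¬)
open import Data.Fin.Subset using (Subset; _∈_; ∣_∣)
open import Data.Vec using (tabulate)
open import Data.Vec.Properties using (lookup∘tabulate; []=⇒lookup; lookup⇒[]=)
open import Data.Vec.Functional.Properties using (updateAt-updates; updateAt-minimal)
import Data.Vec.Functional as Vector
open import Data.Rational using (ℚ; 0ℚ)
import Data.Rational as ℚ
open import Data.Rational.Properties using (1≢0)
import Data.Rational.Properties as ℚ
open import Data.Product using (Σ; ∃; _×_; _,_; proj₁; proj₂)
open import Data.Sum using (_⊎_; inj₁; inj₂; [_,_])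
open import Data.Unit using (tt)
open import Function using (_∘_; id; const)
open import Level using (0ℓ)
open import Relation.Binary.PropositionalEquality
  using (_≡_; _≢_; refl; sym; trans; cong; cong₂; subst; module ≡-Reasoning)
open import Relation.Nullary using (¬_; contradiction; yes; no; does)
open import Relation.Nullary.Decidable using (dec-true; dec-false)
open import Relation.Unary using (Pred; Decidable; _⊆_; _∪_)
open import Relation.Unary.Properties using (_∪?_)

xor-cancelˡ : ∀ a b → a xor (a xor b) ≡ b
xor-cancelˡ a b = trans (sym (xor-assoc a a b)) (cong (_xor b) (xor-same a))

xor-cancel-middle : ∀ a b c → (a xor b) xor (b xor c) ≡ a xor c
xor-cancel-middle a b c = trans (xor-assoc a b (b xor c)) (cong (a xor_) (xor-cancelˡ b c))

xor-cancel-shared : ∀ a b c → (a xor b) xor (a xor c) ≡ b xor c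
xor-cancel-shared a b c = trans (cong (_xor (a xor c)) (xor-comm a b)) (xor-cancel-middle b a c)

≢-xor : ∀ {a b c e} → a ≢ b → a xor b ≡ c xor e → c ≢ e
≢-xor {true}  {true}          a≢b _  _    = a≢b refl
≢-xor {false} {false}         a≢b _  _    = a≢b refl
≢-xor {true}  {false} {c = c} _   eq refl = contradiction (trans eq (xor-same c)) λ ()
≢-xor {false} {true}  {c = c} _   eq refl = contradiction (trans eq (xor-same c)) λ ()

module _ {d n : ℕ} where

  Proper : (P U : Idx d n → Set) → (Idx d n → Bool) → Set
  Proper P U σ = (α γ : Idx d n) → U α → P α → U γ → P γ → Adjacent α γ → σ α ≢ σ γ

  ConnectedBipartite : (P U : Idx d n → Set) → Set
  ConnectedBipartite P U = ConnectedIn P U × Σ (Idx d n → Bool) (Proper P U)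

  Δ : (Idx d n → Bool) → Idx d n → Idx d n → Bool
  Δ σ x y = σ x xor σ y

  Δ-sym : ∀ σ x y → Δ σ x y ≡ Δ σ y x
  Δ-sym σ x y = xor-comm (σ x) (σ y)

  Δ-telescope : ∀ σ x w y → Δ σ x y ≡ Δ σ x w xor Δ σ w y
  Δ-telescope σ x w y = sym (xor-cancel-middle (σ x) (σ w) (σ y))

  Δ-telescope₃ : ∀ σ x v w y → Δ σ x y ≡ Δ σ x v xor (Δ σ v w xor Δ σ w y)
  Δ-telescope₃ σ x v w y = trans (Δ-telescope σ x v y) (cong (Δ σ x v xor_) (Δ-telescope σ v w y))

  module _ {U : Idx d n → Set} where

    PathIn-map : ∀ {P Q x y} → P ⊆ Q → PathIn P U x y → PathIn Q U x y
    PathIn-map P⊆Q here               = here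
    PathIn-map P⊆Q (step u p adj path) = step u (P⊆Q p) adj (PathIn-map P⊆Q path)

    _++_ : ∀ {P x y z} → PathIn P U x y → PathIn P U y z → PathIn P U x z
    here                ++ path′ = path′
    step u p adj path   ++ path′ = step u p adj (path ++ path′)

    parity : ∀ {P x y} → PathIn P U x y → Bool
    parity here              = false
    parity (step _ _ _ path) = not (parity path)

    Δ≡parity : ∀ {P Q σ x y} → P ⊆ Q → Proper Q U σ → U x → P x →
               (path : PathIn P U x y) → Δ σ x y ≡ parity path
    Δ≡parity {σ = σ} {x} {y} P⊆Q proper ux px (step {γ = γ} uγ pγ adj path) = begin
      σ x xor σ y           ≡⟨ cong (_xor σ y) (¬-not (proper x γ ux (P⊆Q px) uγ (P⊆Q pγ) adj)) ⟩
      not (σ γ) xor σ y     ≡⟨ sym (not-distribˡ-xor (σ γ) (σ y)) ⟩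
      not (Δ σ γ y)         ≡⟨ cong not (Δ≡parity P⊆Q proper uγ pγ path) ⟩
      not (parity path)     ∎
      where open ≡-Reasoning
    Δ≡parity {σ = σ} {x} _ _ _ _ here = xor-same (σ x)

    Δ-path-invariant : ∀ {P Q R σ τ x y} → P ⊆ Q → P ⊆ R → Proper Q U σ → Proper R U τ →
                       U x → P x → PathIn P U x y → Δ σ x y ≡ Δ τ x y
    Δ-path-invariant P⊆Q P⊆R σ-proper τ-proper ux px path =
      trans (Δ≡parity P⊆Q σ-proper ux px path) (sym (Δ≡parity P⊆R τ-proper ux px path))

    ConnectedBipartite-≐ : ∀ {P Q} → P ⊆ Q → Q ⊆ P → ConnectedBipartite P U → ConnectedBipartite Q U
    ConnectedBipartite-≐ P⊆Q Q⊆P (connected , σ , proper) =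
      (λ α γ uα qα uγ qγ → PathIn-map P⊆Q (connected α γ uα (Q⊆P qα) uγ (Q⊆P qγ))) ,
      σ , (λ α γ uα qα uγ qγ → proper α γ uα (Q⊆P qα) uγ (Q⊆P qγ))

  Adjacent-direction : ∀ {x y : Idx d n} → Adjacent x y → ∀ j → x j ≢ y j → ∀ z → z ≢ j → x z ≡ y z
  Adjacent-direction (_ , i , agree) j xj≢yj z z≢j with i Fin.≟ j
  ... | yes refl = agree z z≢j
  ... | no  i≢j  = contradiction (agree j (i≢j ∘ sym)) xj≢yj

count : (ℕ → Bool) → ℕ → ℕ
count f zero    = 0
count f (suc n) = (if f 0 then suc else id) (count (f ∘ suc) n)

count-false : ∀ n → count (const false) n ≡ 0
count-false zero    = refl
count-false (suc n) = count-false n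

count-< : ∀ c n → c ≤ n → count (does ∘ (_<? c)) n ≡ c
count-< zero    n       _         = count-false n
count-< (suc c) (suc n) (s≤s c≤n) = cong suc (count-< c n c≤n)

count-≡ : ∀ b n → b < n → count (does ∘ (ℕ._≟ b)) n ≡ 1
count-≡ zero    (suc n) _         = cong suc (count-false n)
count-≡ (suc b) (suc n) (s≤s b<n) = count-≡ b n b<n

count-∪ : ∀ {P Q : Pred ℕ 0ℓ} (P? : Decidable P) (Q? : Decidable Q) → (∀ {z} → P z → ¬ Q z) →
          ∀ n → count (does ∘ (P? ∪? Q?)) n ≡ count (does ∘ P?) n + count (does ∘ Q?) n
count-∪ P? Q? disjoint zero = refl
count-∪ P? Q? disjoint (suc n) with P? 0 | Q? 0 | count-∪ (P? ∘ suc) (Q? ∘ suc) disjoint n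
... | yes p | yes q | _  = contradiction q (disjoint p)
... | yes _ | no  _ | ih = cong suc ih
... | no  _ | yes _ | ih = trans (cong suc ih) (sym (+-suc _ _))
... | no  _ | no  _ | ih = ih

count-∪-≡ : ∀ {P : Pred ℕ 0ℓ} (P? : Decidable P) b n → P ⊆ (_< b) → b < n →
            count (does ∘ (P? ∪? (ℕ._≟ b))) n ≡ count (does ∘ P?) n + 1
count-∪-≡ P? b n P⊆<b b<n =
  trans (count-∪ P? (ℕ._≟ b) (λ pz z≡b → <-irrefl z≡b (P⊆<b pz)) n) (cong (_ +_) (count-≡ b n b<n))

-- Sets of free directions are decidable predicates on ℕ, read through toℕ.
module _ {d : ℕ} {F : Pred ℕ 0ℓ} where

  freeSubset : Decidable F → Subset d
  freeSubset F? = tabulate (does ∘ F? ∘ toℕ)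

  ∈freeSubset : ∀ (F? : Decidable F) {i} → F (toℕ i) → i ∈ freeSubset F?
  ∈freeSubset F? {i} Fi = lookup⇒[]= i _ (trans (lookup∘tabulate _ i) (dec-true (F? (toℕ i)) Fi))

∣freeSubset∣ : ∀ d {F} (F? : Decidable F) → ∣ freeSubset {d} F? ∣ ≡ count (does ∘ F?) d
∣freeSubset∣ zero    F? = refl
∣freeSubset∣ (suc d) F? with F? 0
... | yes _ = cong suc (∣freeSubset∣ d (F? ∘ suc))
... | no  _ = ∣freeSubset∣ d (F? ∘ suc)

record OnPlane {d n : ℕ} (F : Pred ℕ 0ℓ) (b α : Idx d n) : Set where
  constructor onPlane
  field fixed : ∀ z → ¬ F (toℕ z) → α z ≡ b z
open OnPlane

module _ {d n : ℕ} {F : Pred ℕ 0ℓ} where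

  onPlane-refl : ∀ {b : Idx d n} → OnPlane F b b
  onPlane-refl = onPlane λ _ _ → refl

  onPlane-sym : ∀ {b α : Idx d n} → OnPlane F b α → OnPlane F α b
  onPlane-sym α∈ = onPlane λ z ¬Fz → sym (fixed α∈ z ¬Fz)

  onPlane-⊆ : ∀ {G b c} → F ⊆ G → OnPlane G c b → OnPlane F b ⊆ OnPlane {d} {n} G c
  onPlane-⊆ F⊆G b∈ α∈ = onPlane λ z ¬Gz → trans (fixed α∈ z (¬Gz ∘ F⊆G)) (fixed b∈ z ¬Gz)

  onPlane-update : ∀ {b α : Idx d n} i t → F (toℕ i) → OnPlane F b α → OnPlane F b (α [ i ≔ t ])
  onPlane-update {α = α} i t Fi α∈ = onPlane λ z ¬Fz →
    trans (updateAt-minimal z i α (λ { refl → ¬Fz Fi })) (fixed α∈ z ¬Fz)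

  InPlane⇒OnPlane : ∀ (F? : Decidable F) {b : Idx d n} → InPlane (freeSubset F?) b ⊆ OnPlane F b
  InPlane⇒OnPlane F? α∈ = onPlane λ z ¬Fz → α∈ z λ z∈ →
    contradiction (trans (sym (lookup∘tabulate (does ∘ F? ∘ toℕ) z)) ([]=⇒lookup z∈)) (λ does≡true →
      contradiction (trans (sym does≡true) (dec-false (F? (toℕ z)) ¬Fz)) λ ())

  OnPlane⇒InPlane : ∀ (F? : Decidable F) {b : Idx d n} → OnPlane F b ⊆ InPlane (freeSubset F?) b
  OnPlane⇒InPlane F? α∈ z z∉ = fixed α∈ z (z∉ ∘ ∈freeSubset F?)

onPlane-everything : ∀ {d n} {b α : Idx d n} → OnPlane (_< d) b α
onPlane-everything = onPlane λ z z≮d → contradiction (toℕ<n z) z≮d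

foldr-zeros : ∀ m (f : Fin m → ℚ) → (∀ t → f t ≡ 0ℚ) → Vector.foldr ℚ._+_ 0ℚ f ≡ 0ℚ
foldr-zeros zero    f f≡0 = refl
foldr-zeros (suc m) f f≡0 =
  trans (cong₂ ℚ._+_ (f≡0 Fin.zero) (foldr-zeros m (f ∘ Fin.suc) (f≡0 ∘ Fin.suc)))
        (ℚ.+-identityˡ 0ℚ)

line-meets-support : ∀ {d n} {A : Matrix d n} → DoublePermutation A →
                     ∀ α i → ∃ λ t → Support A (α [ i ≔ t ])
line-meets-support {n = n} {A} (_ , line-sums) α i =
  ¬∀⟶∃¬ n _ (λ t → A (α [ i ≔ t ]) ℚ.≟ 0ℚ)
    (λ all-zero → 1≢0 (trans (sym (line-sums α i)) (foldr-zeros n _ all-zero)))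

PlanesConnectedBipartite : ∀ {d n} → Matrix d n → ℕ → Set₁
PlanesConnectedBipartite {d} {n} A c =
  ∀ {F} (F? : Decidable F) → count (does ∘ F?) d ≡ c →
  (b : Idx d n) → ConnectedBipartite (OnPlane F b) (Support A)

allPlanes⇒planesConnectedBipartite : ∀ {d n} {A : Matrix d n} {c} →
                                     AllPlanesConnectedBitrade A c → PlanesConnectedBipartite A c
allPlanes⇒planesConnectedBipartite {d} hyp F? count≡c b
  with hyp (freeSubset F?) (trans (∣freeSubset∣ d F?) count≡c) b
... | connected , _ , colouring =
  ConnectedBipartite-≐ (InPlane⇒OnPlane F?) (OnPlane⇒InPlane F?) (connected , colouring)

module Extension {d′ n : ℕ} (A : Matrix (suc d′) n) (dp : DoublePermutation A)
  (a : ℕ) (0<a : 0 < a) (k+1≤d : suc a + 1 ≤ suc d′)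
  (planes-k : PlanesConnectedBipartite A (suc a))
  (planes-k+1 : PlanesConnectedBipartite A (suc a + 1)) where

  d k : ℕ
  d = suc d′
  k = suc a

  U : Idx d n → Set
  U = Support A

  k<d : k < d
  k<d = subst (_≤ d) (+-comm k 1) k+1≤d

  PrefixPlanesConnectedBipartite : ℕ → Set
  PrefixPlanesConnectedBipartite m = (b : Idx d n) → ConnectedBipartite (OnPlane (_< m) b) U

  module Extend (m : ℕ) (k<m : k < m) (m<d : m < d)
    (prefix-m : PrefixPlanesConnectedBipartite m) (β : Idx d n) where

    j : Fin d
    j = fromℕ< m<d

    toℕ-j : toℕ j ≡ m
    toℕ-j = toℕ-fromℕ< m<d

    toℕ≡m⇒≡j : ∀ {z} → toℕ z ≡ m → z ≡ j
    toℕ≡m⇒≡j z≡m = toℕ-injective (trans z≡m (sym toℕ-j))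

    j≢zero : j ≢ Fin.zero
    j≢zero j≡0 = contradiction (subst (k <_) (trans (sym toℕ-j) (cong toℕ j≡0)) k<m) λ ()

    Π : Idx d n → Set
    Π = OnPlane (_< suc m) β

    Slice : Fin n → Idx d n → Set
    Slice t = OnPlane (_< m) (β [ j ≔ t ])

    Π⇒Slice : ∀ {x} → Π x → Slice (x j) x
    Π⇒Slice {x} x∈Π = onPlane fixed-off-prefix
      where
      fixed-off-prefix : ∀ z → ¬ toℕ z < m → x z ≡ (β [ j ≔ x j ]) z
      fixed-off-prefix z z≮m with z Fin.≟ j
      ... | yes refl = sym (updateAt-updates j β)
      ... | no  z≢j  = trans
        (fixed x∈Π z λ z<1+m → z≢j (toℕ≡m⇒≡j (≤∧≮⇒≡ (s≤s⁻¹ z<1+m) z≮m)))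
        (sym (updateAt-minimal z j β z≢j))

    Slice⊆Π : ∀ {t} → Slice t ⊆ Π
    Slice⊆Π {t} =
      onPlane-⊆ m≤n⇒m≤1+n (onPlane-update j t (subst (_< suc m) (sym toℕ-j) (n<1+n m)) onPlane-refl)

    slice-colour : Fin n → Idx d n → Bool
    slice-colour t = proj₁ (proj₂ (prefix-m (β [ j ≔ t ])))

    slice-proper : ∀ t → Proper (Slice t) U (slice-colour t)
    slice-proper t = proj₂ (proj₂ (prefix-m (β [ j ≔ t ])))

    Vertical : Pred ℕ 0ℓ → Pred ℕ 0ℓ
    Vertical H = H ∪ (_≡ m)

    Hinge : Pred ℕ 0ℓ
    Hinge = Vertical (_< a)

    same-level : ∀ {H} {b x y : Idx d n} → OnPlane (Vertical H) b x → OnPlane (Vertical H) b y →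
                 y j ≡ x j → OnPlane H x y
    same-level {H} {x = x} {y} x∈ y∈ yj≡xj = onPlane fixed-off-H
      where
      fixed-off-H : ∀ z → ¬ H (toℕ z) → y z ≡ x z
      fixed-off-H z ¬Hz with z Fin.≟ j
      ... | yes refl = yj≡xj
      ... | no  z≢j  = trans (fixed y∈ z ¬Vz) (sym (fixed x∈ z ¬Vz))
        where
        ¬Vz : ¬ Vertical H (toℕ z)
        ¬Vz = [ ¬Hz , z≢j ∘ toℕ≡m⇒≡j ]

    -- Direction 0 lies below a, so it is free in every vertical plane used.
    anchor : Idx d n → Fin n → Idx d n
    anchor b s = (b [ j ≔ s ]) [ Fin.zero ≔ proj₁ (line-meets-support dp (b [ j ≔ s ]) Fin.zero) ]

    anchor∈U : ∀ b s → U (anchor b s)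
    anchor∈U b s = proj₂ (line-meets-support dp (b [ j ≔ s ]) Fin.zero)

    anchor-j : ∀ {b s} → anchor b s j ≡ s
    anchor-j {b} = trans (updateAt-minimal j Fin.zero _ j≢zero) (updateAt-updates j b)

    anchor∈plane : ∀ {F b s} → F 0 → F m → OnPlane F b (anchor b s)
    anchor∈plane {F} {s = s} F0 Fm =
      onPlane-update Fin.zero _ F0 (onPlane-update j s (subst F (sym toℕ-j) Fm) onPlane-refl)

    record VerticalPlane : Set₁ where
      field
        Hor       : Pred ℕ 0ℓ
        hor?      : Decidable Hor
        count-hor : count (does ∘ hor?) d ≡ k
        hor⊆      : Hor ⊆ (_< m)
        below-a⊆  : (_< a) ⊆ Hor
        base      : Idx d n
        base∈Π    : Π base

    module _ (W : VerticalPlane) where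
      open VerticalPlane W

      plane : Idx d n → Set
      plane = OnPlane (Vertical Hor) base

      plane-connectedBipartite : ConnectedBipartite plane U
      plane-connectedBipartite = planes-k+1 (hor? ∪? (ℕ._≟ m))
        (trans (count-∪-≡ hor? m d hor⊆ m<d) (cong (_+ 1) count-hor)) base

      colour : Idx d n → Bool
      colour = proj₁ (proj₂ plane-connectedBipartite)

      colour-proper : Proper plane U colour
      colour-proper = proj₂ (proj₂ plane-connectedBipartite)

      plane⊆Π : plane ⊆ Π
      plane⊆Π = onPlane-⊆ [ m≤n⇒m≤1+n ∘ hor⊆ , (λ { refl → n<1+n m }) ] base∈Π

      horizontal⊆plane : ∀ {x} → plane x → OnPlane Hor x ⊆ plane
      horizontal⊆plane = onPlane-⊆ inj₁

      horizontal⊆Slice : ∀ {x} → plane x → OnPlane Hor x ⊆ Slice (x j)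
      horizontal⊆Slice x∈ = onPlane-⊆ hor⊆ (Π⇒Slice (plane⊆Π x∈))

      hinge⊆plane : ∀ {b} → plane b → OnPlane Hinge b ⊆ plane
      hinge⊆plane = onPlane-⊆ [ inj₁ ∘ below-a⊆ , inj₂ ]

    a<m : a < m
    a<m = <-trans (n<1+n a) k<m

    count-below-a+1 : count (does ∘ (_<? a)) d + 1 ≡ k
    count-below-a+1 = trans (cong (_+ 1) (count-< a d (<⇒≤ (<-trans a<m m<d)))) (+-comm a 1)

    hinge-connected : ∀ b → ConnectedIn (OnPlane Hinge b) U
    hinge-connected b = proj₁ (planes-k ((_<? a) ∪? (ℕ._≟ m))
      (trans (count-∪-≡ (_<? a) m d (λ z<a → <-trans z<a a<m) m<d) count-below-a+1) b)

    anchor∈hinge : ∀ {b s} → OnPlane Hinge b (anchor b s)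
    anchor∈hinge = anchor∈plane (inj₁ 0<a) (inj₂ refl)

    Qplane : (γ : Idx d n) → Π γ → VerticalPlane
    Qplane γ γ∈Π = record
      { Hor = _< k ; hor? = _<? k ; count-hor = count-< k d (<⇒≤ k<d)
      ; hor⊆ = λ z<k → <-trans z<k k<m ; below-a⊆ = m≤n⇒m≤1+n
      ; base = γ ; base∈Π = γ∈Π }

    Rplane : ∀ ℓ → k ≤ ℓ → ℓ < m → (γ : Idx d n) → Π γ → VerticalPlane
    Rplane ℓ k≤ℓ ℓ<m γ γ∈Π = record
      { Hor = (_< a) ∪ (_≡ ℓ) ; hor? = (_<? a) ∪? (ℕ._≟ ℓ)
      ; count-hor = trans (count-∪-≡ (_<? a) ℓ d (λ z<a → <-trans z<a k≤ℓ) (<-trans ℓ<m m<d))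
                          count-below-a+1
      ; hor⊆ = [ (λ z<a → <-trans z<a a<m) , (λ { refl → ℓ<m }) ] ; below-a⊆ = inj₁
      ; base = γ ; base∈Π = γ∈Π }

    Q₀ : VerticalPlane
    Q₀ = Qplane β onPlane-refl

    -- Slice s gets its own colouring, flipped to agree with Q₀ at anchor β s.
    τ-in : Fin n → Idx d n → Bool
    τ-in s x = colour Q₀ (anchor β s) xor Δ (slice-colour s) (anchor β s) x

    τ : Idx d n → Bool
    τ x = τ-in (x j) x

    Δτ-slice : ∀ {x y} → y j ≡ x j → Δ τ x y ≡ Δ (slice-colour (x j)) x y
    Δτ-slice {x} {y} yj≡xj = begin
      τ x xor τ y                          ≡⟨ cong (λ t → τ x xor τ-in t y) yj≡xj ⟩
      τ-in s x xor τ-in s y                ≡⟨ xor-cancel-shared (colour Q₀ r) (Δ σ r x) (Δ σ r y) ⟩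
      Δ σ r x xor Δ σ r y                  ≡⟨ cong (_xor Δ σ r y) (Δ-sym σ r x) ⟩
      Δ σ x r xor Δ σ r y                  ≡⟨ sym (Δ-telescope σ x r y) ⟩
      Δ σ x y                              ∎
      where
      open ≡-Reasoning
      s : Fin n
      s = x j
      r : Idx d n
      r = anchor β s
      σ : Idx d n → Bool
      σ = slice-colour s

    Δ-anchor-slice : ∀ W {b x} → plane W b → U x → plane W x →
                     Δ (colour W) x (anchor b (x j)) ≡ Δ (slice-colour (x j)) x (anchor b (x j))
    Δ-anchor-slice W {b} {x} b∈W ux x∈W =
      Δ-path-invariant (horizontal⊆plane W x∈W) (horizontal⊆Slice W x∈W)
        (colour-proper W) (slice-proper (x j)) ux onPlane-refl path
      where
      open VerticalPlane W
      x̃∈W : plane W (anchor b (x j))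
      x̃∈W = hinge⊆plane W b∈W anchor∈hinge
      path : PathIn (OnPlane Hor x) U x (anchor b (x j))
      path = proj₁ (planes-k hor? count-hor x) x (anchor b (x j)) ux onPlane-refl (anchor∈U b (x j))
               (same-level x∈W x̃∈W anchor-j)

    Δ-anchor : ∀ W {b x} → plane W b → U x → plane W x →
               Δ (colour W) x (anchor b (x j)) ≡ Δ τ x (anchor b (x j))
    Δ-anchor W b∈W ux x∈W = trans (Δ-anchor-slice W b∈W ux x∈W) (sym (Δτ-slice anchor-j))

    Compatible : VerticalPlane → Set
    Compatible W = ∀ {x y} → U x → plane W x → U y → plane W y → Δ (colour W) x y ≡ Δ τ x y

    -- x and y are joined inside their slices to anchors on the hinge through b, shared by V and W.
    transfer : ∀ V W {b} → plane V b → plane W b → Compatible V → Compatible W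
    transfer V W {b} b∈V b∈W compatible {x} {y} ux x∈W uy y∈W = begin
      Δ σ x y                                   ≡⟨ Δ-telescope₃ σ x x̃ ỹ y ⟩
      Δ σ x x̃ xor (Δ σ x̃ ỹ xor Δ σ ỹ y)         ≡⟨ cong₂ _xor_ start (cong₂ _xor_ middle end) ⟩
      Δ τ x x̃ xor (Δ τ x̃ ỹ xor Δ τ ỹ y)         ≡⟨ sym (Δ-telescope₃ τ x x̃ ỹ y) ⟩
      Δ τ x y                                   ∎
      where
      open ≡-Reasoning
      σ : Idx d n → Bool
      σ = colour W
      x̃ ỹ : Idx d n
      x̃ = anchor b (x j)
      ỹ = anchor b (y j)
      start : Δ σ x x̃ ≡ Δ τ x x̃
      start = Δ-anchor W b∈W ux x∈W
      middle : Δ σ x̃ ỹ ≡ Δ τ x̃ ỹ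
      middle = trans
        (Δ-path-invariant (hinge⊆plane W b∈W) (hinge⊆plane V b∈V)
          (colour-proper W) (colour-proper V) (anchor∈U b (x j)) anchor∈hinge
          (hinge-connected b x̃ ỹ (anchor∈U b (x j)) anchor∈hinge (anchor∈U b (y j)) anchor∈hinge))
        (compatible (anchor∈U b (x j)) (hinge⊆plane V b∈V anchor∈hinge)
                    (anchor∈U b (y j)) (hinge⊆plane V b∈V anchor∈hinge))
      end : Δ σ ỹ y ≡ Δ τ ỹ y
      end = trans (Δ-sym σ ỹ y) (trans (Δ-anchor W b∈W uy y∈W) (Δ-sym τ y ỹ))

    τ≡colour-Q₀ : ∀ {x} → U x → plane Q₀ x → τ x ≡ colour Q₀ x
    τ≡colour-Q₀ {x} ux x∈Q₀ = begin
      σ r xor Δ (slice-colour (x j)) r x   ≡⟨ cong (σ r xor_) Δr≡ ⟩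
      σ r xor Δ σ r x                      ≡⟨ xor-cancelˡ (σ r) (σ x) ⟩
      σ x                                  ∎
      where
      open ≡-Reasoning
      σ : Idx d n → Bool
      σ = colour Q₀
      r : Idx d n
      r = anchor β (x j)
      Δr≡ : Δ (slice-colour (x j)) r x ≡ Δ σ r x
      Δr≡ = trans (Δ-sym (slice-colour (x j)) r x)
                  (trans (sym (Δ-anchor-slice Q₀ onPlane-refl ux x∈Q₀)) (Δ-sym σ x r))

    compatible-Q₀ : Compatible Q₀
    compatible-Q₀ ux x∈ uy y∈ = cong₂ _xor_ (sym (τ≡colour-Q₀ ux x∈)) (sym (τ≡colour-Q₀ uy y∈))

    AgreesFrom : ℕ → Idx d n → Set
    AgreesFrom ℓ γ = ∀ z → ℓ ≤ toℕ z → toℕ z < m → γ z ≡ β z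

    -- Reset coordinate ℓ = e + k of γ to β's; the Q-planes before and after meet R in hinges.
    compatible-Q-agreeing : ∀ e → e + k ≤ m → ∀ γ (γ∈Π : Π γ) → AgreesFrom (e + k) γ →
                            Compatible (Qplane γ γ∈Π)
    compatible-Q-agreeing zero _ γ γ∈Π agrees =
      transfer Q₀ (Qplane γ γ∈Π) γ∈Q₀ onPlane-refl compatible-Q₀
      where
      fixed-off-Q : ∀ z → ¬ Vertical (_< k) (toℕ z) → γ z ≡ β z
      fixed-off-Q z ¬Vz with toℕ z <? m
      ... | yes z<m = agrees z (≮⇒≥ (¬Vz ∘ inj₁)) z<m
      ... | no  z≮m = fixed γ∈Π z λ z<1+m → ¬Vz (inj₂ (≤∧≮⇒≡ (s≤s⁻¹ z<1+m) z≮m))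
      γ∈Q₀ : plane Q₀ γ
      γ∈Q₀ = onPlane fixed-off-Q
    compatible-Q-agreeing (suc e) ℓ<m γ γ∈Π agrees =
      transfer R (Qplane γ γ∈Π) γ∈R onPlane-refl
        (transfer (Qplane γ′ γ′∈Π) R onPlane-refl onPlane-refl
          (compatible-Q-agreeing e (<⇒≤ ℓ<m) γ′ γ′∈Π γ′-agrees))
      where
      ℓ : ℕ
      ℓ = e + k
      ℓ<d : ℓ < d
      ℓ<d = <-trans ℓ<m m<d
      i : Fin d
      i = fromℕ< ℓ<d
      γ′ : Idx d n
      γ′ = γ [ i ≔ β i ]
      γ′∈Π : Π γ′
      γ′∈Π = onPlane-update i (β i) (subst (_< suc m) (sym (toℕ-fromℕ< ℓ<d)) (m≤n⇒m≤1+n ℓ<m)) γ∈Π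
      γ′-agrees : AgreesFrom ℓ γ′
      γ′-agrees z ℓ≤z z<m with z Fin.≟ i
      ... | yes refl = updateAt-updates i γ
      ... | no  z≢i  = trans (updateAt-minimal z i γ z≢i) (agrees z ℓ<z z<m)
        where
        ℓ<z : ℓ < toℕ z
        ℓ<z = ≤∧≢⇒< ℓ≤z λ ℓ≡z → z≢i (toℕ-injective (trans (sym ℓ≡z) (sym (toℕ-fromℕ< ℓ<d))))
      R : VerticalPlane
      R = Rplane ℓ (m≤n+m k e) ℓ<m γ′ γ′∈Π
      γ∈R : plane R γ
      γ∈R = onPlane-sym (onPlane-update i (β i) (inj₁ (inj₂ (toℕ-fromℕ< ℓ<d))) onPlane-refl)

    compatible-Q : ∀ γ (γ∈Π : Π γ) → Compatible (Qplane γ γ∈Π)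
    compatible-Q γ γ∈Π = compatible-Q-agreeing (m ∸ k) (≤-reflexive m-k+k) γ γ∈Π
      λ z m≤z z<m → contradiction (subst (_≤ toℕ z) m-k+k m≤z) (<⇒≱ z<m)
      where
      m-k+k : m ∸ k + k ≡ m
      m-k+k = m∸n+n≡m (<⇒≤ k<m)

    Π-connected : ConnectedIn Π U
    Π-connected x y ux x∈Π uy y∈Π =
      PathIn-map (plane⊆Π Q)
        (proj₁ (plane-connectedBipartite Q) x x̃ ux onPlane-refl (anchor∈U x (y j)) x̃∈Q) ++
      PathIn-map Slice⊆Π
        (proj₁ (prefix-m (β [ j ≔ y j ])) x̃ y (anchor∈U x (y j)) x̃∈Slice uy (Π⇒Slice y∈Π))
      where
      Q : VerticalPlane
      Q = Qplane x x∈Π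
      x̃ : Idx d n
      x̃ = anchor x (y j)
      x̃∈Q : plane Q x̃
      x̃∈Q = anchor∈plane (inj₁ z<s) (inj₂ refl)
      x̃∈Slice : Slice (y j) x̃
      x̃∈Slice = subst (λ t → Slice t x̃) anchor-j (Π⇒Slice (plane⊆Π Q x̃∈Q))

    τ-proper : Proper Π U τ
    τ-proper x y ux x∈Π uy y∈Π adj with y j Fin.≟ x j
    ... | yes yj≡xj = ≢-xor
      (slice-proper (x j) x y ux (Π⇒Slice x∈Π) uy (subst (λ t → Slice t y) yj≡xj (Π⇒Slice y∈Π)) adj)
      (sym (Δτ-slice yj≡xj))
    ... | no  yj≢xj = ≢-xor
      (colour-proper (Qplane x x∈Π) x y ux onPlane-refl uy y∈Q adj)
      (compatible-Q x x∈Π ux onPlane-refl uy y∈Q)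
      where
      y∈Q : plane (Qplane x x∈Π) y
      y∈Q = onPlane λ z ¬Vz →
        sym (Adjacent-direction adj j (yj≢xj ∘ sym) z (λ { refl → ¬Vz (inj₂ toℕ-j) }))

    extend : ConnectedBipartite Π U
    extend = Π-connected , τ , τ-proper

  prefix-planes : ∀ e → e + suc k ≤ d → PrefixPlanesConnectedBipartite (e + suc k)
  prefix-planes zero    k<d′ = planes-k+1 (_<? suc k) (trans (count-< (suc k) d k<d′) (+-comm 1 k))
  prefix-planes (suc e) m<d  =
    Extend.extend (e + suc k) (m≤n+m (suc k) e) m<d (prefix-planes e (<⇒≤ m<d))

  full-planes : PrefixPlanesConnectedBipartite d
  full-planes = subst PrefixPlanesConnectedBipartite d-k-1+k+1
    (prefix-planes (d ∸ suc k) (≤-reflexive d-k-1+k+1))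
    where
    d-k-1+k+1 : d ∸ suc k + suc k ≡ d
    d-k-1+k+1 = m∸n+n≡m k<d

unitrade-from-planes : ∀ {d n} {A : Matrix d n} k → k < d →
                       AllPlanesConnectedBitrade A (k + 1) → UnitradeIn full Everything (Support A)
unitrade-from-planes {d} k k<d planes α _ i _ =
  proj₁ (proj₂ (planes (freeSubset F?) ∣S∣≡k+1 α)) α (λ _ _ → refl) i (∈freeSubset F? i-free)
  where
  b : ℕ
  b = k ⊔ toℕ i
  F? : Decidable ((_< k) ∪ (_≡ b))
  F? = (_<? k) ∪? (ℕ._≟ b)
  ∣S∣≡k+1 : ∣ freeSubset {d} F? ∣ ≡ k + 1
  ∣S∣≡k+1 = trans (∣freeSubset∣ d F?)
    (trans (count-∪-≡ (_<? k) b d (λ z<k → <-≤-trans z<k (m≤m⊔n k (toℕ i))) (⊔-lub k<d (toℕ<n i)))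
           (cong (_+ 1) (count-< k d (<⇒≤ k<d))))
  i-free : toℕ i < k ⊎ toℕ i ≡ b
  i-free with toℕ i <? k
  ... | yes i<k = inj₁ i<k
  ... | no  i≮k = inj₂ (sym (m≤n⇒m⊔n≡n (≮⇒≥ i≮k)))

whole-space-colouring : ∀ {d′ n} {U : Idx (suc d′) n → Set} →
  ((b : Idx (suc d′) n) → Σ (Idx (suc d′) n → Bool) (Proper (OnPlane (_< suc d′) b) U)) →
  Σ (Idx (suc d′) n → Bool) (Proper Everything U)
whole-space-colouring {n = zero}  _          = const true , λ α → contradiction (α Fin.zero) λ ()
whole-space-colouring {n = suc _} colourings with colourings (const Fin.zero)
... | σ , proper = σ , λ α γ uα _ uγ _ → proper α γ uα onPlane-everything uγ onPlane-everything

whole-space : ∀ {d′ n} {U : Idx (suc d′) n → Set} →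
              ((b : Idx (suc d′) n) → ConnectedBipartite (OnPlane (_< suc d′) b) U) →
              ConnectedBipartite Everything U
whole-space planes = connected , whole-space-colouring (proj₂ ∘ planes)
  where
  connected : ConnectedIn Everything _
  connected α γ uα _ uγ _ =
    PathIn-map (const tt) (proj₁ (planes α) α γ uα onPlane-everything uγ onPlane-everything)

lemma1 : (d n k : ℕ) (A : Matrix d n) → DoublePermutation A →
    2 ≤ k → k + 1 ≤ d →
    AllPlanesConnectedBitrade A k → AllPlanesConnectedBitrade A (k + 1) →
    SupportConnectedBitrade A
lemma1 d       n zero    A dp ()        _     _     _
lemma1 zero    n (suc a) A dp _         ()    _     _
lemma1 (suc d′) n (suc a) A dp (s≤s 0<a) k+1≤d hk hk1 =
  proj₁ whole , unitrade-from-planes (suc a) k<d hk1 , proj₂ whole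
  where
  open Extension A dp a 0<a k+1≤d
    (allPlanes⇒planesConnectedBipartite hk) (allPlanes⇒planesConnectedBipartite hk1)
  whole : ConnectedBipartite Everything U
  whole = whole-space full-planes
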